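{- Let $n\geq 2$ and $L_1,\dots,L_n\geq 2$ be integers. (i) $pc(P_{L_1}\Box P_{L_2}\Box\cdots\Box P_{L_n})=2$. (ii) If there exists some $j\in\{1,\dots,n\}$ with $L_j\neq 2$, then $pc(P_{L_1}\circ P_{L_2}\circ\cdots\circ P_{L_n})=2$; if $L_1=L_2=\cdots=L_n=2$, then $pc(P_{L_1}\circ P_{L_2}\circ\cdots\circ P_{L_n})=1$.
   Context: $P_k$ denotes the path on $k$ vertices. In an edge-colored graph (adjacent edges may receive the same color), a path is a proper path if no two adjacent edges of the path have the same color. The proper connection number $pc(G)$ of a connected graph $G$ is the minimum number of colors in an edge-coloring of $G$ such that every two distinct vertices are joined by a proper path. The Cartesian product $G\Box H$ has vertex set $V(G)\times V(H)$, with $(g,h)\sim(g',h')$ iff ($g=g'$ and $hh'\in E(H)$) or ($h=h'$ and $gg'\in E(G)$). The lexicographic product $G\circ H$ has vertex set $V(G)\times V(H)$, with $(g,h)\sim(g',h')$ iff $gg'\in E(G)$, or ($g=g'$ and $hh'\in E(H)$). Iterated products are taken left to right. -}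

module Defs where

open import Data.Nat using (ℕ; zero; suc; _<_)
open import Data.Fin using (Fin; toℕ)
open import Data.List using (List; []; _∷_; foldl; last)
open import Data.Maybe using (just)
open import Data.Product using (_×_; _,_; Σ; ∃)
open import Data.Sum using (_⊎_)
open import Data.Unit using (⊤)
open import Relation.Nullary using (¬_)
open import Relation.Binary.PropositionalEquality using (_≡_; _≢_)
open import Data.List.Relation.Unary.Linked using (Linked)
open import Data.List.Relation.Unary.Unique.Propositional using (Unique)

record Graph : Set₁ where
  field
    V   : Set
    Adj : V → V → Set
open Graph public

P : ℕ → Graph
P k = record { V = Fin k ; Adj = λ i j → (suc (toℕ i) ≡ toℕ j) ⊎ (suc (toℕ j) ≡ toℕ i) }

_□_ : Graph → Graph → Graph
G □ H = record
  { V = V G × V H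
  ; Adj = λ { (g , h) (g' , h') → (g ≡ g' × Adj H h h') ⊎ (h ≡ h' × Adj G g g') } }

_⊚_ : Graph → Graph → Graph
G ⊚ H = record
  { V = V G × V H
  ; Adj = λ { (g , h) (g' , h') → Adj G g g' ⊎ (g ≡ g' × Adj H h h') } }

iter : (Graph → Graph → Graph) → ℕ → List ℕ → Graph
iter _⊙_ L₁ Ls = foldl (λ G l → G ⊙ P l) (P L₁) Ls

-- Edge colouring with (at most) k colours: a colour for each ordered pair,
-- required symmetric on edges (only values on edges matter).
EdgeColouring : Graph → ℕ → Set
EdgeColouring G k =
  Σ (V G → V G → Fin k) λ c → ∀ u v → Adj G u v → c u v ≡ c v u

ProperColours : {A : Set} {k : ℕ} → (A → A → Fin k) → List A → Set
ProperColours c (a ∷ b ∷ d ∷ rest) = (c a b ≢ c b d) × ProperColours c (b ∷ d ∷ rest)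
ProperColours c _ = ⊤

ProperPath : (G : Graph) {k : ℕ} → (V G → V G → Fin k) → V G → V G → Set
ProperPath G c x y =
  Σ (List (V G)) λ vs →
    Linked (Adj G) (x ∷ vs) × Unique (x ∷ vs) ×
    last (x ∷ vs) ≡ just y × ProperColours c (x ∷ vs)

ProperlyConnectable : Graph → ℕ → Set
ProperlyConnectable G k =
  Σ (EdgeColouring G k) λ { (c , _) →
    ∀ x y → x ≢ y → ProperPath G c x y }

PC≡ : Graph → ℕ → Set
PC≡ G k = ProperlyConnectable G k × (∀ m → m < k → ¬ ProperlyConnectable G m)

module Submission where

-- A graph with a Hamiltonian path v₀ … vₙ is properly connected by two colours: colour the
-- edge uv by the parity of min(index u, index v), so that walking along the path in either
-- direction alternates colours. Products of paths have Hamiltonian paths (a snake through the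
-- copies of the first factor, traversed alternately forwards and backwards), and the
-- lexicographic product contains the Cartesian one. One colour cannot suffice once two
-- distinct vertices are non-adjacent, which happens in every Cartesian product and in the
-- lexicographic product as soon as some factor has three vertices. If every factor is P₂ the
-- lexicographic product is complete, so one colour suffices.

open import Defs
open import Data.Nat
open import Data.Nat.Properties
open import Data.Nat.DivMod
open import Data.Nat.Divisibility using (n∣m*n)
open import Data.Fin using (Fin; zero; suc; toℕ)
open import Data.Fin.Properties using (toℕ-fromℕ<; toℕ<n; toℕ-injective)
import Data.Fin.Properties as Fin
open import Data.List using (List; []; _∷_; foldl; last; applyUpTo)
open import Data.List.Relation.Unary.All using (All; []; _∷_)
open import Data.List.Relation.Unary.Any using (Any; here; there)
open import Data.List.Relation.Unary.Linked using (Linked; []; [-]; _∷_)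
open import Data.List.Relation.Unary.AllPairs using ([]; _∷_)
import Data.List.Relation.Unary.Unique.Propositional.Properties as Unique
open import Data.Maybe using (just)
open import Data.Maybe.Properties using (just-injective)
open import Data.Product using (Σ; ∃; _×_; _,_; proj₁; proj₂)
open import Data.Product.Properties using (≡-dec)
open import Data.Sum using (inj₁; inj₂)
open import Data.Unit using (tt)
open import Function using (_∘_)
open import Relation.Binary.Definitions using (Symmetric; Irreflexive; DecidableEquality)
open import Relation.Binary.PropositionalEquality
open import Relation.Nullary using (¬_; yes; no; contradiction)

parity₂ : ℕ → Fin 2
parity₂ zero          = zero
parity₂ (suc zero)    = suc zero
parity₂ (suc (suc i)) = parity₂ i

parity₂-suc : ∀ i → parity₂ (suc i) ≢ parity₂ i
parity₂-suc zero          ()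
parity₂-suc (suc zero)    ()
parity₂-suc (suc (suc i)) = parity₂-suc i

module _ {A : Set} where

  applyUpTo-linked : (R : A → A → Set) (f : ℕ → A) (n : ℕ) →
    (∀ {i} → suc i < n → R (f i) (f (suc i))) → Linked R (applyUpTo f n)
  applyUpTo-linked R f zero          _    = []
  applyUpTo-linked R f (suc zero)    _    = [-]
  applyUpTo-linked R f (suc (suc n)) step =
    step (s<s z<s) ∷ applyUpTo-linked R (f ∘ suc) (suc n) (step ∘ s<s)

  last-applyUpTo : (f : ℕ → A) (n : ℕ) → last (applyUpTo f (suc n)) ≡ just (f n)
  last-applyUpTo f zero    = refl
  last-applyUpTo f (suc n) = last-applyUpTo (f ∘ suc) n

  applyUpTo-properColours : ∀ {k} (c : A → A → Fin k) (f : ℕ → A) (n : ℕ) →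
    (∀ {i} → suc (suc i) < n → c (f i) (f (suc i)) ≢ c (f (suc i)) (f (suc (suc i)))) →
    ProperColours c (applyUpTo f n)
  applyUpTo-properColours c f zero                _   = tt
  applyUpTo-properColours c f (suc zero)          _   = tt
  applyUpTo-properColours c f (suc (suc zero))    _   = tt
  applyUpTo-properColours c f (suc (suc (suc n))) alt =
    alt (s<s (s<s z<s)) , applyUpTo-properColours c (f ∘ suc) (suc (suc n)) (alt ∘ s<s)

applyUpTo-properPath : ∀ (G : Graph) {k} (c : V G → V G → Fin k) (f : ℕ → V G) (n : ℕ) →
  (∀ {i} → i < n → Adj G (f i) (f (suc i))) →
  (∀ {i j} → i < j → j ≤ n → f i ≢ f j) →
  (∀ {i} → suc (suc i) ≤ n → c (f i) (f (suc i)) ≢ c (f (suc i)) (f (suc (suc i)))) →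
  ProperPath G c (f 0) (f n)
applyUpTo-properPath G c f n step injective alt =
    applyUpTo (f ∘ suc) n
  , applyUpTo-linked (Adj G) f (suc n) (step ∘ s<s⁻¹)
  , Unique.applyUpTo⁺₁ f (suc n) (λ i<j j<1+n → injective i<j (s≤s⁻¹ j<1+n))
  , last-applyUpTo f n
  , applyUpTo-properColours c f (suc n) (alt ∘ s<s⁻¹)

-- vertex 0, …, vertex n list every vertex exactly once; vertex is junk beyond n.
record HamiltonianPath (G : Graph) (n : ℕ) : Set where
  field
    vertex       : ℕ → V G
    index        : V G → ℕ
    index≤       : ∀ v → index v ≤ n
    vertex-index : ∀ v → vertex (index v) ≡ v
    index-vertex : ∀ {i} → i ≤ n → index (vertex i) ≡ i
    adjacent     : ∀ {i} → i < n → Adj G (vertex i) (vertex (suc i))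

  vertex-injective : ∀ {i j} → i ≤ n → j ≤ n → vertex i ≡ vertex j → i ≡ j
  vertex-injective {i} {j} i≤n j≤n eq = begin
    i                ≡⟨ index-vertex i≤n ⟨
    index (vertex i) ≡⟨ cong index eq ⟩
    index (vertex j) ≡⟨ index-vertex j≤n ⟩
    j                ∎
    where open ≡-Reasoning

open HamiltonianPath

reverse : ∀ {G n} → Symmetric (Adj G) → HamiltonianPath G n → HamiltonianPath G n
reverse {G} {n} sym-G H = record
  { vertex       = λ i → vertex H (n ∸ i)
  ; index        = λ v → n ∸ index H v
  ; index≤       = λ v → m∸n≤m n (index H v)
  ; vertex-index = λ v → trans (cong (vertex H) (m∸[m∸n]≡n (index≤ H v))) (vertex-index H v)
  ; index-vertex = λ {i} i≤n → trans (cong (n ∸_) (index-vertex H (m∸n≤m n i))) (m∸[m∸n]≡n i≤n)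
  ; adjacent     = adjacent-reversed
  }
  where
    adjacent-reversed : ∀ {i} → i < n → Adj G (vertex H (n ∸ i)) (vertex H (n ∸ suc i))
    adjacent-reversed {i} i<n = subst (λ j → Adj G (vertex H j) (vertex H (n ∸ suc i)))
      (sym n∸i≡1+n∸[1+i]) (sym-G (adjacent H n∸[1+i]<n))
      where
        n∸i≡1+n∸[1+i] : n ∸ i ≡ suc (n ∸ suc i)
        n∸i≡1+n∸[1+i] = +-∸-assoc 1 i<n
        n∸[1+i]<n : n ∸ suc i < n
        n∸[1+i]<n = subst (_≤ n) n∸i≡1+n∸[1+i] (m∸n≤m n i)

module _ {G : Graph} {n k : ℕ} (c : V G → V G → Fin k) where

  Alternating : HamiltonianPath G n → Set
  Alternating H = ∀ {i} → suc (suc i) ≤ n →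
    c (vertex H i) (vertex H (suc i)) ≢ c (vertex H (suc i)) (vertex H (suc (suc i)))

  -- Consecutive edges i, i+1 of the reversed path are the edges j+1, j of H, with j = n ∸ (i+2).
  alternating-reverse : (sym-G : Symmetric (Adj G)) → (∀ u v → c u v ≡ c v u) →
    ∀ H → Alternating H → Alternating (reverse sym-G H)
  alternating-reverse sym-G c-sym H alt {i} 2+i≤n
    rewrite +-∸-assoc 1 (<-trans (n<1+n i) 2+i≤n) | +-∸-assoc 1 2+i≤n
    = λ eq → alt (subst (_≤ n) (+-∸-assoc 2 2+i≤n) (m∸n≤m n i)) (begin
        c (vertex H j) (vertex H (suc j))                 ≡⟨ c-sym _ _ ⟩
        c (vertex H (suc j)) (vertex H j)                 ≡⟨ eq ⟨
        c (vertex H (suc (suc j))) (vertex H (suc j))     ≡⟨ c-sym _ _ ⟩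
        c (vertex H (suc j)) (vertex H (suc (suc j)))     ∎)
    where
      open ≡-Reasoning
      j = n ∸ suc (suc i)

  properPath-forward : ∀ H → Alternating H → ∀ {i j} → i ≤ j → j ≤ n →
    ProperPath G c (vertex H i) (vertex H j)
  properPath-forward H alt {i} {j} i≤j j≤n =
    subst (ProperPath G c (vertex H i) ∘ vertex H) (m∸n+n≡m i≤j)
      (applyUpTo-properPath G c (λ t → vertex H (t + i)) (j ∸ i) step injective alt′)
    where
      below-n : ∀ {t} → t ≤ j ∸ i → t + i ≤ n
      below-n t≤ = ≤-trans (+-monoˡ-≤ i t≤) (subst (_≤ n) (sym (m∸n+n≡m i≤j)) j≤n)
      step : ∀ {t} → t < j ∸ i → Adj G (vertex H (t + i)) (vertex H (suc t + i))
      step t< = adjacent H (below-n t<)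
      injective : ∀ {t s} → t < s → s ≤ j ∸ i → vertex H (t + i) ≢ vertex H (s + i)
      injective t<s s≤ eq = <⇒≢ t<s (+-cancelʳ-≡ i _ _
        (vertex-injective H (below-n (<⇒≤ (<-≤-trans t<s s≤))) (below-n s≤) eq))
      alt′ : ∀ {t} → suc (suc t) ≤ j ∸ i →
        c (vertex H (t + i)) (vertex H (suc t + i)) ≢
        c (vertex H (suc t + i)) (vertex H (suc (suc t) + i))
      alt′ 2+t≤ = alt (below-n 2+t≤)

  properPath-ordered : ∀ H → Alternating H → ∀ {x y} → index H x ≤ index H y → ProperPath G c x y
  properPath-ordered H alt {x} {y} ix≤iy =
    subst₂ (ProperPath G c) (vertex-index H x) (vertex-index H y)
      (properPath-forward H alt ix≤iy (index≤ H y))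

  properlyConnected : (sym-G : Symmetric (Adj G)) → (∀ u v → c u v ≡ c v u) →
    ∀ H → Alternating H → ∀ x y → ProperPath G c x y
  properlyConnected sym-G c-sym H alt x y with index H x ≤? index H y
  ... | yes ix≤iy = properPath-ordered H alt ix≤iy
  ... | no  ix≰iy = properPath-ordered (reverse sym-G H) (alternating-reverse sym-G c-sym H alt)
                      (∸-monoʳ-≤ n (≰⇒≥ ix≰iy))

module _ {G : Graph} {n : ℕ} (H : HamiltonianPath G n) where

  parityColouring : V G → V G → Fin 2
  parityColouring u v = parity₂ (index H u ⊓ index H v)

  parityColouring-sym : ∀ u v → parityColouring u v ≡ parityColouring v u
  parityColouring-sym u v = cong parity₂ (⊓-comm (index H u) (index H v))

  parityColouring-edge : ∀ {i} → i < n → parityColouring (vertex H i) (vertex H (suc i)) ≡ parity₂ i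
  parityColouring-edge {i} i<n
    rewrite index-vertex H (<⇒≤ i<n) | index-vertex H i<n = cong parity₂ (m≤n⇒m⊓n≡m (n≤1+n i))

  parityColouring-alternating : Alternating parityColouring H
  parityColouring-alternating {i} 2+i≤n eq = parity₂-suc i (begin
    parity₂ (suc i)                                             ≡⟨ parityColouring-edge 2+i≤n ⟨
    parityColouring (vertex H (suc i)) (vertex H (suc (suc i))) ≡⟨ eq ⟨
    parityColouring (vertex H i) (vertex H (suc i))             ≡⟨ parityColouring-edge (<-trans (n<1+n i) 2+i≤n) ⟩
    parity₂ i                                                   ∎)
    where open ≡-Reasoning

hamiltonian⇒properlyConnectable₂ : ∀ {G n} → Symmetric (Adj G) → HamiltonianPath G n →
  ProperlyConnectable G 2
hamiltonian⇒properlyConnectable₂ sym-G H =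
    (parityColouring H , λ u v _ → parityColouring-sym H u v)
  , λ x y _ → properlyConnected (parityColouring H) sym-G (parityColouring-sym H)
                H (parityColouring-alternating H) x y

module _ (q : ℕ) {r N : ℕ} .{{_ : NonZero N}} (r<N : r < N) where

  [q*N+r]%N≡r : (q * N + r) % N ≡ r
  [q*N+r]%N≡r = trans (%-remove-+ˡ r (n∣m*n q)) (m<n⇒m%n≡m r<N)

  [q*N+r]/N≡q : (q * N + r) / N ≡ q
  [q*N+r]/N≡q = begin
    (q * N + r) / N   ≡⟨ +-distrib-/-∣ˡ r (n∣m*n q) ⟩
    q * N / N + r / N ≡⟨ cong₂ _+_ (m*n/n≡m q N) (m<n⇒m/n≡0 r<N) ⟩
    q + 0             ≡⟨ +-identityʳ q ⟩
    q                 ∎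
    where open ≡-Reasoning

[m/n]*n+m%n≡m : ∀ m n .{{_ : NonZero n}} → m / n * n + m % n ≡ m
[m/n]*n+m%n≡m m n = trans (+-comm (m / n * n) (m % n)) (sym (m≡m%n+[m/n]*n m n))

module _ {G H : Graph} (sym-G : Symmetric (Adj G)) {n m : ℕ}
         (g : HamiltonianPath G n) (h : HamiltonianPath H m) where

  row : ℕ → HamiltonianPath G n
  row zero    = g
  row (suc q) = reverse sym-G (row q)

  snake : ℕ → V G × V H
  snake i = vertex (row (i / suc n)) (i % suc n) , vertex h (i / suc n)

  snake-index : V G × V H → ℕ
  snake-index (x , y) = index h y * suc n + index (row (index h y)) x

  snake-at : ∀ q {r} → r ≤ n → snake (q * suc n + r) ≡ (vertex (row q) r , vertex h q)
  snake-at q r≤n rewrite [q*N+r]/N≡q q (s≤s r≤n) | [q*N+r]%N≡r q (s≤s r≤n) = refl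

  snake-next-row : ∀ q → suc (q * suc n + n) ≡ suc q * suc n + 0
  snake-next-row q = trans (cong suc (+-comm (q * suc n) n)) (sym (+-identityʳ _))

  -- Passing from the end of row q to the start of row q + 1 is a step in H,
  -- because the rows alternate direction.
  snake-adjacent-at : ∀ q {r} → r ≤ n → suc (q * suc n + r) ≤ m * suc n + n →
    Adj (G □ H) (snake (q * suc n + r)) (snake (suc (q * suc n + r)))
  snake-adjacent-at q {r} r≤n bound with m≤n⇒m<n∨m≡n r≤n
  ... | inj₁ r<n = subst₂ (Adj (G □ H)) (sym (snake-at q r≤n))
    (sym (trans (cong snake (sym (+-suc (q * suc n) r))) (snake-at q r<n)))
    (inj₂ (refl , adjacent (row q) r<n))
  ... | inj₂ refl = subst₂ (Adj (G □ H)) (sym (snake-at q r≤n))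
    (sym (trans (cong snake (snake-next-row q)) (snake-at (suc q) z≤n)))
    (inj₁ (refl , adjacent h (*-cancelʳ-< (suc n) q m (+-cancelʳ-< n (q * suc n) (m * suc n) bound))))

  hamiltonian-□ : HamiltonianPath (G □ H) (m * suc n + n)
  hamiltonian-□ = record
    { vertex       = snake
    ; index        = snake-index
    ; index≤       = λ { (x , y) →
                         +-mono-≤ (*-monoˡ-≤ (suc n) (index≤ h y)) (index≤ (row (index h y)) x) }
    ; vertex-index = λ { (x , y) → trans (snake-at (index h y) (index≤ (row (index h y)) x))
                                         (cong₂ _,_ (vertex-index (row (index h y)) x) (vertex-index h y)) }
    ; index-vertex = snake-index-vertex
    ; adjacent     = snake-adjacent
    }
    where
      quotient≤m : ∀ {i} → i ≤ m * suc n + n → i / suc n ≤ m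
      quotient≤m {i} i≤ =
        s≤s⁻¹ (m<n*o⇒m/o<n {i} (subst (i <_) (cong suc (+-comm (m * suc n) n)) (s≤s i≤)))

      remainder≤n : ∀ i → i % suc n ≤ n
      remainder≤n i = s≤s⁻¹ (m%n<n i (suc n))

      snake-index-vertex : ∀ {i} → i ≤ m * suc n + n → snake-index (snake i) ≡ i
      snake-index-vertex {i} i≤
        rewrite index-vertex h (quotient≤m i≤) | index-vertex (row (i / suc n)) (remainder≤n i) =
        [m/n]*n+m%n≡m i (suc n)

      snake-adjacent : ∀ {i} → i < m * suc n + n → Adj (G □ H) (snake i) (snake (suc i))
      snake-adjacent {i} i< =
        subst (λ j → Adj (G □ H) (snake j) (snake (suc j))) ([m/n]*n+m%n≡m i (suc n))
        (snake-adjacent-at (i / suc n) (remainder≤n i)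
          (subst (λ j → suc j ≤ m * suc n + n) (sym ([m/n]*n+m%n≡m i (suc n))) i<))

hamiltonian-spanning : ∀ {A : Set} {E E′ : A → A → Set} {n} → (∀ {u v} → E u v → E′ u v) →
  HamiltonianPath (record { V = A ; Adj = E }) n → HamiltonianPath (record { V = A ; Adj = E′ }) n
hamiltonian-spanning E⊆E′ H = record
  { vertex = vertex H ; index = index H ; index≤ = index≤ H
  ; vertex-index = vertex-index H ; index-vertex = index-vertex H
  ; adjacent = E⊆E′ ∘ adjacent H
  }

□⊆⊚ : ∀ {G H u v} → Adj (G □ H) u v → Adj (G ⊚ H) u v
□⊆⊚ (inj₁ (refl , h~h′)) = inj₂ (refl , h~h′)
□⊆⊚ (inj₂ (refl , g~g′)) = inj₁ g~g′

hamiltonian-⊚ : ∀ {G H n m} → Symmetric (Adj G) →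
  HamiltonianPath G n → HamiltonianPath H m → HamiltonianPath (G ⊚ H) (m * suc n + n)
hamiltonian-⊚ {G} {H} sym-G g h = hamiltonian-spanning (□⊆⊚ {G} {H}) (hamiltonian-□ sym-G g h)

P-hamiltonian : ∀ m → HamiltonianPath (P (suc m)) m
P-hamiltonian m = record
  { vertex       = λ i → i mod suc m
  ; index        = toℕ
  ; index≤       = λ v → s≤s⁻¹ (toℕ<n v)
  ; vertex-index = λ v → toℕ-injective (trans (toℕ-fromℕ< _) (m<n⇒m%n≡m (toℕ<n v)))
  ; index-vertex = λ i≤m → trans (toℕ-fromℕ< _) (m≤n⇒m%n≡m i≤m)
  ; adjacent     = λ {i} i<m → inj₁ (begin
      suc (toℕ (i mod suc m)) ≡⟨ cong suc (trans (toℕ-fromℕ< _) (m≤n⇒m%n≡m (<⇒≤ i<m))) ⟩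
      suc i                   ≡⟨ trans (toℕ-fromℕ< _) (m≤n⇒m%n≡m i<m) ⟨
      toℕ (suc i mod suc m)   ∎)
  }
  where open ≡-Reasoning

P-symmetric : ∀ l → Symmetric (Adj (P l))
P-symmetric l (inj₁ e) = inj₂ e
P-symmetric l (inj₂ e) = inj₁ e

□-symmetric : ∀ {G H} → Symmetric (Adj G) → Symmetric (Adj H) → Symmetric (Adj (G □ H))
□-symmetric sym-G sym-H (inj₁ (refl , h~h′)) = inj₁ (refl , sym-H h~h′)
□-symmetric sym-G sym-H (inj₂ (refl , g~g′)) = inj₂ (refl , sym-G g~g′)

⊚-symmetric : ∀ {G H} → Symmetric (Adj G) → Symmetric (Adj H) → Symmetric (Adj (G ⊚ H))
⊚-symmetric sym-G sym-H (inj₁ g~g′)          = inj₁ (sym-G g~g′)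
⊚-symmetric sym-G sym-H (inj₂ (refl , h~h′)) = inj₂ (refl , sym-H h~h′)

NonAdjacentPair : Graph → Set
NonAdjacentPair G = Σ (V G) λ x → Σ (V G) λ y → x ≢ y × ¬ Adj G x y

Complete : Graph → Set
Complete G = ∀ x y → x ≢ y → Adj G x y

¬properlyConnectable₀ : ∀ {G} → V G → ¬ ProperlyConnectable G 0
¬properlyConnectable₀ x ((c , _) , _) with c x x
... | ()

-- With a single colour a proper path has at most one edge.
¬properlyConnectable₁ : ∀ {G} → NonAdjacentPair G → ¬ ProperlyConnectable G 1
¬properlyConnectable₁ {G} (x , y , x≢y , x≁y) ((c , _) , connected) with connected x y x≢y
... | []         , _         , _ , x≡y , _ = x≢y (just-injective x≡y)
... | v ∷ []     , x~v ∷ [-] , _ , v≡y , _ = x≁y (subst (Adj G x) (just-injective v≡y) x~v)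
... | v ∷ w ∷ _  , _         , _ , _   , (c≢ , _) with c x v | c v w | c≢
...   | zero | zero | c≢′ = c≢′ refl

complete⇒properlyConnectable₁ : ∀ {G} → Complete G → ProperlyConnectable G 1
complete⇒properlyConnectable₁ complete =
    ((λ _ _ → zero) , λ _ _ _ → refl)
  , λ x y x≢y → y ∷ [] , complete x y x≢y ∷ [-] , (x≢y ∷ []) ∷ [] ∷ [] , refl , tt

SymmetricHamiltonian : Graph → Set
SymmetricHamiltonian G = Symmetric (Adj G) × ∃ (HamiltonianPath G)

pc≡2 : ∀ {G} → SymmetricHamiltonian G → NonAdjacentPair G → PC≡ G 2
pc≡2 {G} (sym-G , _ , H) nonAdjacent = hamiltonian⇒properlyConnectable₂ sym-G H , fewer
  where
    fewer : ∀ k → k < 2 → ¬ ProperlyConnectable G k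
    fewer zero       _ = ¬properlyConnectable₀ (vertex H 0)
    fewer (suc zero) _ = ¬properlyConnectable₁ nonAdjacent
    fewer (suc (suc _)) (s≤s (s≤s ()))

pc≡1 : ∀ {G} → V G → Complete G → PC≡ G 1
pc≡1 x complete = complete⇒properlyConnectable₁ complete , λ
  { zero    _        → ¬properlyConnectable₀ x
  ; (suc _) (s≤s ()) }

□-nonAdjacentPair : ∀ {G H} {x y : V G} {h h′ : V H} → x ≢ y → h ≢ h′ → NonAdjacentPair (G □ H)
□-nonAdjacentPair x≢y h≢h′ = _ , _ , x≢y ∘ cong proj₁ , λ
  { (inj₁ (x≡y , _))  → x≢y x≡y
  ; (inj₂ (h≡h′ , _)) → h≢h′ h≡h′ }

nonAdjacentPair-□ : ∀ {G H} → NonAdjacentPair G → V H → NonAdjacentPair (G □ H)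
nonAdjacentPair-□ (x , y , x≢y , x≁y) h = (x , h) , (y , h) , x≢y ∘ cong proj₁ , λ
  { (inj₁ (x≡y , _)) → x≢y x≡y
  ; (inj₂ (_ , x~y)) → x≁y x~y }

nonAdjacentPair-⊚ : ∀ {G H} → NonAdjacentPair G → V H → NonAdjacentPair (G ⊚ H)
nonAdjacentPair-⊚ (x , y , x≢y , x≁y) h = (x , h) , (y , h) , x≢y ∘ cong proj₁ , λ
  { (inj₁ x~y)       → x≁y x~y
  ; (inj₂ (x≡y , _)) → x≢y x≡y }

⊚-nonAdjacentPairʳ : ∀ {G H} → Irreflexive _≡_ (Adj G) → V G → NonAdjacentPair H →
  NonAdjacentPair (G ⊚ H)
⊚-nonAdjacentPairʳ irr-G g (h , h′ , h≢h′ , h≁h′) = (g , h) , (g , h′) , h≢h′ ∘ cong proj₂ , λ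
  { (inj₁ g~g)       → irr-G refl g~g
  ; (inj₂ (_ , h~h′)) → h≁h′ h~h′ }

P-nonAdjacentPair : ∀ {l} → 3 ≤ l → NonAdjacentPair (P l)
P-nonAdjacentPair (s≤s (s≤s (s≤s _))) = zero , suc (suc zero) , (λ ()) , λ { (inj₁ ()) ; (inj₂ ()) }

P-irreflexive : ∀ l → Irreflexive _≡_ (Adj (P l))
P-irreflexive l refl (inj₁ e) = 1+n≢n e
P-irreflexive l refl (inj₂ e) = 1+n≢n e

⊚-irreflexive : ∀ {G H} → Irreflexive _≡_ (Adj G) → Irreflexive _≡_ (Adj H) →
  Irreflexive _≡_ (Adj (G ⊚ H))
⊚-irreflexive irr-G irr-H refl (inj₁ g~g)      = irr-G refl g~g
⊚-irreflexive irr-G irr-H refl (inj₂ (_ , h~h)) = irr-H refl h~h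

⊚-complete : ∀ {G H} → DecidableEquality (V G) → Complete G → Complete H → Complete (G ⊚ H)
⊚-complete _≟G_ complete-G complete-H (g , h) (g′ , h′) ≢ with g ≟G g′
... | no  g≢g′ = inj₁ (complete-G g g′ g≢g′)
... | yes refl = inj₂ (refl , complete-H h h′ (≢ ∘ cong (g ,_)))

P₂-complete : Complete (P 2)
P₂-complete zero       zero       ≢ = contradiction refl ≢
P₂-complete zero       (suc zero) _ = inj₁ refl
P₂-complete (suc zero) zero       _ = inj₂ refl
P₂-complete (suc zero) (suc zero) ≢ = contradiction refl ≢

foldl-preserves : (_⊙_ : Graph → Graph → Graph) {A : ℕ → Set} (Q : Graph → Set) →
  (∀ {G l} → A l → Q G → Q (G ⊙ P l)) →
  ∀ {G} Ls → All A Ls → Q G → Q (foldl (λ G l → G ⊙ P l) G Ls)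
foldl-preserves _⊙_ Q step []       []         q = q
foldl-preserves _⊙_ Q step (l ∷ Ls) (al ∷ all) q = foldl-preserves _⊙_ Q step Ls all (step al q)

nonAdjacentPair-foldl : (_⊙_ : Graph → Graph → Graph) →
  (∀ {G H} → NonAdjacentPair G → V H → NonAdjacentPair (G ⊙ H)) →
  ∀ {G} Ls → All (2 ≤_) Ls → NonAdjacentPair G → NonAdjacentPair (foldl (λ G l → G ⊙ P l) G Ls)
nonAdjacentPair-foldl _⊙_ lift = foldl-preserves _⊙_ NonAdjacentPair λ
  { {l = suc _} _ pair → lift pair zero
  ; {l = zero}  () }

⊚-P₂-complete : ∀ {G} Ls → All (_≡ 2) Ls → DecidableEquality (V G) → Complete G →
  Complete (foldl (λ G l → G ⊚ P l) G Ls)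
⊚-P₂-complete Ls all≡2 _≟_ complete =
  proj₂ (foldl-preserves _⊚_ (λ G → DecidableEquality (V G) × Complete G)
    (λ { refl (_≟_ , complete) → ≡-dec _≟_ Fin._≟_ , ⊚-complete _≟_ complete P₂-complete })
    Ls all≡2 (_≟_ , complete))

symmetricHamiltonian-□ : ∀ {G l} → 2 ≤ l → SymmetricHamiltonian G → SymmetricHamiltonian (G □ P l)
symmetricHamiltonian-□ {l = suc l} _ (sym-G , _ , g) =
    □-symmetric {H = P (suc l)} sym-G (P-symmetric (suc l))
  , _ , hamiltonian-□ sym-G g (P-hamiltonian l)

symmetricHamiltonian-⊚ : ∀ {G l} → 2 ≤ l → SymmetricHamiltonian G → SymmetricHamiltonian (G ⊚ P l)
symmetricHamiltonian-⊚ {l = suc l} _ (sym-G , _ , g) =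
    ⊚-symmetric {H = P (suc l)} sym-G (P-symmetric (suc l))
  , _ , hamiltonian-⊚ sym-G g (P-hamiltonian l)

⊚-nonAdjacentPair-any : ∀ {G} Ls → Irreflexive _≡_ (Adj G) → V G →
  All (2 ≤_) Ls → Any (_≢ 2) Ls → NonAdjacentPair (foldl (λ G l → G ⊚ P l) G Ls)
⊚-nonAdjacentPair-any (l ∷ Ls) irr-G g (2≤l ∷ all) (here l≢2) =
  nonAdjacentPair-foldl _⊚_ nonAdjacentPair-⊚ Ls all
    (⊚-nonAdjacentPairʳ irr-G g (P-nonAdjacentPair (≤∧≢⇒< 2≤l (l≢2 ∘ sym))))
⊚-nonAdjacentPair-any (suc l ∷ Ls) irr-G g (_ ∷ all) (there any) =
  ⊚-nonAdjacentPair-any Ls (⊚-irreflexive irr-G (P-irreflexive (suc l))) (g , zero) all any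

proposition4 : (L₁ L₂ : ℕ) (Ls : List ℕ) → All (2 ≤_) (L₁ ∷ L₂ ∷ Ls) →
    PC≡ (iter _□_ L₁ (L₂ ∷ Ls)) 2
    × (Any (_≢ 2) (L₁ ∷ L₂ ∷ Ls) → PC≡ (iter _⊚_ L₁ (L₂ ∷ Ls)) 2)
    × (All (_≡ 2) (L₁ ∷ L₂ ∷ Ls) → PC≡ (iter _⊚_ L₁ (L₂ ∷ Ls)) 1)
proposition4 (suc (suc a)) (suc (suc b)) Ls (s≤s (s≤s _) ∷ L₂≥2@(s≤s (s≤s _)) ∷ Ls≥2) =
    pc≡2 (iterated _□_ symmetricHamiltonian-□) nonAdjacent-□
  , (λ any≢2 → pc≡2 (iterated _⊚_ symmetricHamiltonian-⊚) (nonAdjacent-⊚ any≢2))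
  , λ { (refl ∷ all≡2) → pc≡1 (vertex (proj₂ (proj₂ (iterated _⊚_ symmetricHamiltonian-⊚))) 0)
                                (⊚-P₂-complete (L₂ ∷ Ls) all≡2 Fin._≟_ P₂-complete) }
  where
    L₂ = suc (suc b)

    iterated : ∀ _⊙_ →
      (∀ {G l} → 2 ≤ l → SymmetricHamiltonian G → SymmetricHamiltonian (G ⊙ P l)) →
      SymmetricHamiltonian (iter _⊙_ (suc (suc a)) (L₂ ∷ Ls))
    iterated _⊙_ step = foldl-preserves _⊙_ SymmetricHamiltonian step (L₂ ∷ Ls) (L₂≥2 ∷ Ls≥2)
      (P-symmetric _ , _ , P-hamiltonian (suc a))

    nonAdjacent-□ : NonAdjacentPair (iter _□_ (suc (suc a)) (L₂ ∷ Ls))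
    nonAdjacent-□ = nonAdjacentPair-foldl _□_ nonAdjacentPair-□ Ls Ls≥2
      (□-nonAdjacentPair {x = zero} {suc zero} {zero} {suc zero} (λ ()) (λ ()))

    nonAdjacent-⊚ : Any (_≢ 2) (suc (suc a) ∷ L₂ ∷ Ls) →
      NonAdjacentPair (iter _⊚_ (suc (suc a)) (L₂ ∷ Ls))
    nonAdjacent-⊚ (here L₁≢2) =
      nonAdjacentPair-foldl _⊚_ nonAdjacentPair-⊚ (L₂ ∷ Ls) (L₂≥2 ∷ Ls≥2)
        (P-nonAdjacentPair (≤∧≢⇒< (s≤s (s≤s z≤n)) (L₁≢2 ∘ sym)))
    nonAdjacent-⊚ (there any≢2) =
      ⊚-nonAdjacentPair-any (L₂ ∷ Ls) (P-irreflexive _) zero (L₂≥2 ∷ Ls≥2) any≢2
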